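{- Let $\hat A$ and $\hat B$ be change actions with $\hat B$ ordered, and let $f:A\to B$ admit derivatives $\partial_\downarrow f$ and $\partial_\uparrow f$. Then every function $g:A\times\Delta A\to\Delta B$ satisfying $\partial_\downarrow f\le_\Delta g\le_\Delta\partial_\uparrow f$ (pointwise) is a derivative of $f$.
   Context: A change action $\hat A=(A,\Delta A,\oplus,+,0)$ consists of a set $A$, a monoid $(\Delta A,+,0)$ and a map $\oplus:A\times\Delta A\to A$ with $a\oplus 0=a$ and $a\oplus(\delta_1+\delta_2)=(a\oplus\delta_1)\oplus\delta_2$. A derivative of $f:A\to B$ is a function $\partial f:A\times\Delta A\to\Delta B$ with $f(a\oplus_A\delta)=f(a)\oplus_B\partial f(a,\delta)$ for all $a,\delta$. A change action $\hat B$ is ordered if $B$ and $\Delta B$ are posets and $\oplus_B:B\times\Delta B\to B$ and $+_B:\Delta B\times\Delta B\to\Delta B$ are monotone. For $\delta_1,\delta_2\in\Delta B$, $\delta_1\le_\Delta\delta_2$ means $b\oplus_B\delta_1\le b\oplus_B\delta_2$ for all $b\in B$; for functions $g,h:A\times\Delta A\to\Delta B$, $g\le_\Delta h$ means $g(a,\delta)\le_\Delta h(a,\delta)$ for all $(a,\delta)$. -}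

module Defs where

open import Level using (Level; _⊔_; suc)
open import Relation.Binary.PropositionalEquality using (_≡_)
open import Relation.Binary.Structures using (IsPartialOrder)
open import Relation.Binary.Core using (Rel)
open import Algebra.Structures using (IsMonoid)
open import Data.Product using (_×_)

record ChangeAction (a : Level) : Set (suc a) where
  field
    Carrier  : Set a
    Δ        : Set a
    _⊕_      : Carrier → Δ → Carrier
    _+_      : Δ → Δ → Δ
    0Δ       : Δ
    isMonoid : IsMonoid _≡_ _+_ 0Δ
    ⊕-identity : ∀ x → x ⊕ 0Δ ≡ x
    ⊕-action   : ∀ x δ₁ δ₂ → x ⊕ (δ₁ + δ₂) ≡ (x ⊕ δ₁) ⊕ δ₂

open ChangeAction public

IsDerivative : ∀ {a b} (A : ChangeAction a) (B : ChangeAction b)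
  → (Carrier A → Carrier B) → (Carrier A → Δ A → Δ B) → Set (a ⊔ b)
IsDerivative A B f ∂f =
  ∀ x δ → f (_⊕_ A x δ) ≡ _⊕_ B (f x) (∂f x δ)

record OrderedStructure {b : Level} (B : ChangeAction b) (ℓ ℓ' : Level)
       : Set (b ⊔ suc ℓ ⊔ suc ℓ') where
  field
    _≤_  : Rel (Carrier B) ℓ
    _≤Δ_ : Rel (Δ B) ℓ'
    ≤-isPartialOrder  : IsPartialOrder _≡_ _≤_
    ≤Δ-isPartialOrder : IsPartialOrder _≡_ _≤Δ_
    ⊕-mono : ∀ {x y δ₁ δ₂} → x ≤ y → δ₁ ≤Δ δ₂
           → _⊕_ B x δ₁ ≤ _⊕_ B y δ₂
    +-mono : ∀ {δ₁ δ₂ δ₃ δ₄} → δ₁ ≤Δ δ₂ → δ₃ ≤Δ δ₄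
           → _+_ B δ₁ δ₃ ≤Δ _+_ B δ₂ δ₄

open OrderedStructure public

_⊑Δ_ : ∀ {b ℓ ℓ'} {B : ChangeAction b} {O : OrderedStructure B ℓ ℓ'}
  → Δ B → Δ B → Set (b ⊔ ℓ)
_⊑Δ_ {B = B} {O = O} δ₁ δ₂ = ∀ y → _≤_ O (_⊕_ B y δ₁) (_⊕_ B y δ₂)

FunLeΔ : ∀ {a b ℓ ℓ'} (A : ChangeAction a) (B : ChangeAction b)
  (O : OrderedStructure B ℓ ℓ')
  → (Carrier A → Δ A → Δ B) → (Carrier A → Δ A → Δ B) → Set (a ⊔ b ⊔ ℓ)
FunLeΔ A B O g h = ∀ x δ → _⊑Δ_ {B = B} {O = O} (g x δ) (h x δ)

module Submission where

open import Defs
open import Relation.Binary.PropositionalEquality using (_≡_; subst; sym)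
open import Relation.Binary.Structures using (IsPartialOrder)

module _ {b ℓ ℓ'} {B : ChangeAction b} (O : OrderedStructure B ℓ ℓ') where

  open IsPartialOrder (≤-isPartialOrder O) using (antisym)

  ⊕-squeeze : ∀ {y z δ₁ δ δ₂} → _⊕_ B y δ₁ ≡ z → _⊕_ B y δ₂ ≡ z
    → _⊑Δ_ {O = O} δ₁ δ → _⊑Δ_ {O = O} δ δ₂ → _⊕_ B y δ ≡ z
  ⊕-squeeze {y} {z} {δ = δ} y⊕δ₁≡z y⊕δ₂≡z δ₁⊑δ δ⊑δ₂ = antisym
    (subst (_≤_ O (_⊕_ B y δ)) y⊕δ₂≡z (δ⊑δ₂ y))
    (subst (λ w → _≤_ O w (_⊕_ B y δ)) y⊕δ₁≡z (δ₁⊑δ y))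

mainTheorem6 : ∀ {a b ℓ ℓ'} (A : ChangeAction a) (B : ChangeAction b)
    (O : OrderedStructure B ℓ ℓ')
    (f : Carrier A → Carrier B)
    (∂↓f ∂↑f g : Carrier A → Δ A → Δ B)
    → IsDerivative A B f ∂↓f
    → IsDerivative A B f ∂↑f
    → FunLeΔ A B O ∂↓f g
    → FunLeΔ A B O g ∂↑f
    → IsDerivative A B f g
mainTheorem6 A B O f ∂↓f ∂↑f g ∂↓f-derivative ∂↑f-derivative ∂↓f≤g g≤∂↑f x δ =
  sym (⊕-squeeze O (sym (∂↓f-derivative x δ)) (sym (∂↑f-derivative x δ))
    (∂↓f≤g x δ) (g≤∂↑f x δ))
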